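{- For $t$ in a neighborhood of zero where both sides converge, \[ \sum_{n=0}^{\infty}L_nH_n(x)\frac{t^n}{n!}=e^{2xt-t^2}\sum_{n=0}^{\infty}(-1)^nL_nH_n(x-t)\frac{t^n}{n!}. \]
   Context: $H_n(x)$ denote the Hermite polynomials, defined by $e^{2xt-t^2}=\sum_{n=0}^\infty H_n(x)\frac{t^n}{n!}$; $L_n$ are the Lucas numbers, $L_0=2$, $L_1=1$, $L_{n+1}=L_n+L_{n-1}$. -}

module Defs where

open import Data.Nat as ℕ using (ℕ; zero; suc; _∸_; _!; _≤ᵇ_)
open import Data.Nat.Properties using (_!≢0)
open import Data.Nat.Combinatorics using (_C_)
open import Data.Integer as ℤ using (ℤ; +_)
open import Data.Rational as ℚ using (ℚ; 0ℚ; 1ℚ; _+_; _*_; -_; _/_)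
open import Data.Bool using (if_then_else_)

lucas : ℕ → ℕ
lucas zero = 2
lucas (suc zero) = 1
lucas (suc (suc n)) = lucas (suc n) ℕ.+ lucas n

ι : ℕ → ℚ
ι n = (+ n) / 1

invFact : ℕ → ℚ
invFact k = (+ 1) / (k !) where instance _ = k !≢0

sgn : ℕ → ℚ
sgn zero = 1ℚ
sgn (suc n) = - sgn n

sumTo : ℕ → (ℕ → ℚ) → ℚ
sumTo zero f = f 0
sumTo (suc n) f = sumTo n f + f (suc n)

-- Formal power series in two variables x, t over ℚ:
-- F a b = coefficient of x^a t^b.
Ser : Set
Ser = ℕ → ℕ → ℚ

_⊛_ : Ser → Ser → Ser
(F ⊛ G) a b = sumTo a λ i → sumTo b λ j → F i j * G (a ∸ i) (b ∸ j)

oneS : Ser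
oneS zero zero = 1ℚ
oneS _ _ = 0ℚ

powS : Ser → ℕ → Ser
powS F zero = oneS
powS F (suc k) = F ⊛ powS F k

-- exp F = Σ_k F^k / k!, for F with zero constant term
-- (then F^k has no monomials of total degree < k, so the sum for the
--  coefficient of x^a t^b is finite, k ≤ a + b)
expS : Ser → Ser
expS F a b = sumTo (a ℕ.+ b) λ k → powS F k a b * invFact k

gen : Ser
gen 1 1 = ι 2
gen 0 2 = - 1ℚ
gen _ _ = 0ℚ

hermiteGF : Ser
hermiteGF = expS gen

-- Hermite polynomials via e^{2xt-t²} = Σ H_n(x) t^n / n!:
-- hermite n i = coefficient of x^i in H_n(x) = n! · [x^i t^n] e^{2xt-t²}
hermite : ℕ → ℕ → ℚ
hermite n i = ι (n !) * hermiteGF i n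

-- H_n(x - t) as a series in x,t: Σ_i hermite n i (x - t)^i,
-- coefficient of x^a t^b is hermite n (a+b) · C(a+b, b) · (-1)^b
hermiteShift : ℕ → Ser
hermiteShift n a b = hermite n (a ℕ.+ b) * ι ((a ℕ.+ b) C b) * sgn b

lhsSer : Ser
lhsSer a n = ι (lucas n) * hermite n a * invFact n

rhsSum : Ser
rhsSum a b = sumTo b λ n → sgn n * ι (lucas n) * invFact n * hermiteShift n a (b ∸ n)

rhsSer : Ser
rhsSer = hermiteGF ⊛ rhsSum

-- Write h = e^{2xt − t²} and Rₖ = tᵏ Hₖ(x − t)/k!. Applying the Euler operators
-- t∂ₜ and x∂ₓ to h gives t∂ₜ h = 2(x − t)t·h and x∂ₓ h = 2xt·h, from which the
-- Hermite recurrences H_{k+1} = 2yHₖ − 2kH_{k−1} and Hₖ' = 2kH_{k−1} follow;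
-- substituting y = x − t they yield (k + 1)·h·R_{k+1} = (t∂ₜ − k)·(h·Rₖ). The
-- series Σ_N C(N, k) H_N(x) t^N/N! obeys the same recursion, since
-- (k + 1)·C(N, k + 1) = (N − k)·C(N, k), and both equal h at k = 0. Hence
-- h·Rₖ = Σ_N C(N, k) H_N(x) t^N/N!, and multiplying by (−1)ᵏ Lₖ and summing over
-- k gives the theorem through the Lucas identity Σₖ (−1)ᵏ C(N, k) Lₖ = L_N.

module Submission where

open import Defs
open import Data.Nat as ℕ using (ℕ; zero; suc; _∸_; _!; _≤_; _<_; z≤n; s≤s)
import Data.Nat.Properties as ℕP
open import Data.Nat.Combinatorics using (_C_; nCn≡1; nC1≡n; k>n⇒nCk≡0; nCk+nC[k+1]≡[n+1]C[k+1])
open import Data.Nat.Tactic.RingSolver using (solve-∀)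
import Data.Integer as ℤ
import Data.Integer.Properties as ℤP
open import Data.Rational using (ℚ; 0ℚ; 1ℚ; _+_; _*_; -_; _/_; mkℚ)
import Data.Rational.Properties as ℚP
open import Data.Rational.Solver using (module +-*-Solver)
open import Data.Nat.Coprimality as Coprime using (1-coprimeTo)
open import Data.Sum using (inj₁; inj₂)
open import Algebra.Properties.Group ℚP.+-0-group using (∙-cancelʳ)
open import Relation.Binary.PropositionalEquality

open +-*-Solver
open ≡-Reasoning

ι≡mkℚ : ∀ n → ι n ≡ mkℚ (ℤ.+ n) 0 (Coprime.sym (1-coprimeTo n))
ι≡mkℚ n = ℚP.normalize-coprime (Coprime.sym (1-coprimeTo n))

ι-+ : ∀ m n → ι (m ℕ.+ n) ≡ ι m + ι n
ι-+ m n = begin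
  ι (m ℕ.+ n)
    ≡⟨ ℚP./-cong (ℤP.pos-+ m n) refl ⟩
  (ℤ.+ m ℤ.+ ℤ.+ n) / 1
    ≡⟨ cong₂ (λ u v → (u ℤ.+ v) / 1) (sym (ℤP.*-identityʳ (ℤ.+ m))) (sym (ℤP.*-identityʳ (ℤ.+ n))) ⟩
  (ℤ.+ m ℤ.* ℤ.+ 1 ℤ.+ ℤ.+ n ℤ.* ℤ.+ 1) / 1
    ≡⟨ cong₂ _+_ (ι≡mkℚ m) (ι≡mkℚ n) ⟨
  ι m + ι n ∎

ι-* : ∀ m n → ι (m ℕ.* n) ≡ ι m * ι n
ι-* m n = trans (ℚP./-cong (ℤP.pos-* m n) refl) (sym (cong₂ _*_ (ι≡mkℚ m) (ι≡mkℚ n)))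

ι-additive : ∀ {m n} → n ≤ m → ι m ≡ ι n + ι (m ∸ n)
ι-additive {m} {n} n≤m = trans (cong ι (sym (ℕP.m+[n∸m]≡n n≤m))) (ι-+ n (m ∸ n))

ι*1/≡1 : ∀ m .{{_ : ℕ.NonZero m}} → ι m * ((ℤ.+ 1) / m) ≡ 1ℚ
ι*1/≡1 (suc m) = begin
  ι (suc m) * ((ℤ.+ 1) / suc m)             ≡⟨ cong₂ _*_ (ι≡mkℚ (suc m)) (ℚP.normalize-coprime (1-coprimeTo (suc m))) ⟩
  r * mkℚ (ℤ.+ 1) m (1-coprimeTo (suc m))  ≡⟨ ℚP.*-inverseʳ r ⟩
  1ℚ                                      ∎
  where r = mkℚ (ℤ.+ suc m) 0 (Coprime.sym (1-coprimeTo (suc m)))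

ι-cancelˡ : ∀ n {x y} → ι (suc n) * x ≡ ι (suc n) * y → x ≡ y
ι-cancelˡ n {x} {y} eq = trans (sym (inverse-cancels x)) (trans (cong (1/n+1 *_) eq) (inverse-cancels y))
  where
  1/n+1 = (ℤ.+ 1) / suc n
  inverse-cancels : ∀ z → 1/n+1 * (ι (suc n) * z) ≡ z
  inverse-cancels z = begin
    1/n+1 * (ι (suc n) * z)   ≡⟨ solve 3 (λ a b c → a :* (b :* c) := (b :* a) :* c) refl 1/n+1 (ι (suc n)) z ⟩
    (ι (suc n) * 1/n+1) * z   ≡⟨ cong (_* z) (ι*1/≡1 (suc n)) ⟩
    1ℚ * z                    ≡⟨ ℚP.*-identityˡ z ⟩
    z                         ∎

ι[k!]*invFact[k]≡1 : ∀ k → ι (k !) * invFact k ≡ 1ℚ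
ι[k!]*invFact[k]≡1 k = ι*1/≡1 (k !) {{k ℕP.!≢0}}

ι[1+k]*invFact[1+k]≡invFact[k] : ∀ k → ι (suc k) * invFact (suc k) ≡ invFact k
ι[1+k]*invFact[1+k]≡invFact[k] k = begin
  i * invFact (suc k)
    ≡⟨ ℚP.*-identityʳ _ ⟨
  i * invFact (suc k) * 1ℚ
    ≡⟨ cong (i * invFact (suc k) *_) (ι[k!]*invFact[k]≡1 k) ⟨
  i * invFact (suc k) * (ι (k !) * invFact k)
    ≡⟨ solve 4 (λ a b c d → (a :* b) :* (c :* d) := (a :* c :* b) :* d) refl i (invFact (suc k)) (ι (k !)) (invFact k) ⟩
  (i * ι (k !) * invFact (suc k)) * invFact k
    ≡⟨ cong (λ u → u * invFact (suc k) * invFact k) (ι-* (suc k) (k !)) ⟨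
  (ι (suc k !) * invFact (suc k)) * invFact k
    ≡⟨ cong (_* invFact k) (ι[k!]*invFact[k]≡1 (suc k)) ⟩
  1ℚ * invFact k
    ≡⟨ ℚP.*-identityˡ _ ⟩
  invFact k ∎
  where i = ι (suc k)

[k+1]*[n+1]C[k+1]≡[n+1]*nCk : ∀ n k → suc k ℕ.* (suc n C suc k) ≡ suc n ℕ.* (n C k)
[k+1]*[n+1]C[k+1]≡[n+1]*nCk n zero = begin
  1 ℕ.* (suc n C 1)   ≡⟨ ℕP.*-identityˡ _ ⟩
  suc n C 1           ≡⟨ nC1≡n (suc n) ⟩
  suc n               ≡⟨ ℕP.*-identityʳ (suc n) ⟨
  suc n ℕ.* 1         ∎
[k+1]*[n+1]C[k+1]≡[n+1]*nCk zero (suc k) = ℕP.*-zeroʳ (suc (suc k))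
[k+1]*[n+1]C[k+1]≡[n+1]*nCk (suc n) (suc k) = begin
  suc (suc k) ℕ.* (suc (suc n) C suc (suc k))
    ≡⟨ cong (suc (suc k) ℕ.*_) (nCk+nC[k+1]≡[n+1]C[k+1] (suc n) (suc k)) ⟨
  suc (suc k) ℕ.* (suc n C suc k ℕ.+ suc n C suc (suc k))
    ≡⟨ split-factor k (suc n C suc k) (suc n C suc (suc k)) ⟩
  suc k ℕ.* (suc n C suc k) ℕ.+ suc n C suc k ℕ.+ suc (suc k) ℕ.* (suc n C suc (suc k))
    ≡⟨ cong₂ (λ u v → u ℕ.+ suc n C suc k ℕ.+ v) ([k+1]*[n+1]C[k+1]≡[n+1]*nCk n k) ([k+1]*[n+1]C[k+1]≡[n+1]*nCk n (suc k)) ⟩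
  suc n ℕ.* (n C k) ℕ.+ suc n C suc k ℕ.+ suc n ℕ.* (n C suc k)
    ≡⟨ cong (λ u → suc n ℕ.* (n C k) ℕ.+ u ℕ.+ suc n ℕ.* (n C suc k)) (nCk+nC[k+1]≡[n+1]C[k+1] n k) ⟨
  suc n ℕ.* (n C k) ℕ.+ (n C k ℕ.+ n C suc k) ℕ.+ suc n ℕ.* (n C suc k)
    ≡⟨ merge-factor n (n C k) (n C suc k) ⟩
  suc (suc n) ℕ.* (n C k ℕ.+ n C suc k)
    ≡⟨ cong (suc (suc n) ℕ.*_) (nCk+nC[k+1]≡[n+1]C[k+1] n k) ⟩
  suc (suc n) ℕ.* (suc n C suc k)
    ∎
  where
  split-factor : ∀ k x y → suc (suc k) ℕ.* (x ℕ.+ y) ≡ suc k ℕ.* x ℕ.+ x ℕ.+ suc (suc k) ℕ.* y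
  split-factor = solve-∀
  merge-factor : ∀ n x y → suc n ℕ.* x ℕ.+ (x ℕ.+ y) ℕ.+ suc n ℕ.* y ≡ suc (suc n) ℕ.* (x ℕ.+ y)
  merge-factor = solve-∀

-- (k + 1)·C(n, k + 1) = (n − k)·C(n, k), stated without truncated subtraction.
[k+1]*nC[k+1]+k*nCk≡n*nCk : ∀ n k → suc k ℕ.* (n C suc k) ℕ.+ k ℕ.* (n C k) ≡ n ℕ.* (n C k)
[k+1]*nC[k+1]+k*nCk≡n*nCk zero zero = refl
[k+1]*nC[k+1]+k*nCk≡n*nCk zero (suc k) = cong₂ ℕ._+_ (ℕP.*-zeroʳ (suc (suc k))) (ℕP.*-zeroʳ (suc k))
[k+1]*nC[k+1]+k*nCk≡n*nCk (suc n) zero = begin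
  1 ℕ.* (suc n C 1) ℕ.+ 0   ≡⟨ ℕP.+-identityʳ _ ⟩
  1 ℕ.* (suc n C 1)         ≡⟨ [k+1]*[n+1]C[k+1]≡[n+1]*nCk n zero ⟩
  suc n ℕ.* 1               ∎
[k+1]*nC[k+1]+k*nCk≡n*nCk (suc n) (suc k) = begin
  suc (suc k) ℕ.* (suc n C suc (suc k)) ℕ.+ suc k ℕ.* (suc n C suc k)
    ≡⟨ cong₂ ℕ._+_ ([k+1]*[n+1]C[k+1]≡[n+1]*nCk n (suc k)) ([k+1]*[n+1]C[k+1]≡[n+1]*nCk n k) ⟩
  suc n ℕ.* (n C suc k) ℕ.+ suc n ℕ.* (n C k)
    ≡⟨ trans (ℕP.+-comm (suc n ℕ.* (n C suc k)) _) (sym (ℕP.*-distribˡ-+ (suc n) (n C k) (n C suc k))) ⟩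
  suc n ℕ.* (n C k ℕ.+ n C suc k)
    ≡⟨ cong (suc n ℕ.*_) (nCk+nC[k+1]≡[n+1]C[k+1] n k) ⟩
  suc n ℕ.* (suc n C suc k)
    ∎

sumTo-cong-≤ : ∀ n {f g : ℕ → ℚ} → (∀ i → i ≤ n → f i ≡ g i) → sumTo n f ≡ sumTo n g
sumTo-cong-≤ zero eq = eq 0 z≤n
sumTo-cong-≤ (suc n) eq = cong₂ _+_ (sumTo-cong-≤ n (λ i i≤n → eq i (ℕP.m≤n⇒m≤1+n i≤n))) (eq (suc n) ℕP.≤-refl)

sumTo-cong : ∀ n {f g : ℕ → ℚ} → (∀ i → f i ≡ g i) → sumTo n f ≡ sumTo n g
sumTo-cong n eq = sumTo-cong-≤ n (λ i _ → eq i)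

sumTo-zero : ∀ n {f : ℕ → ℚ} → (∀ i → i ≤ n → f i ≡ 0ℚ) → sumTo n f ≡ 0ℚ
sumTo-zero n {f} eq = trans (sumTo-cong-≤ n eq) (zeros n)
  where
  zeros : ∀ n → sumTo n (λ _ → 0ℚ) ≡ 0ℚ
  zeros zero = refl
  zeros (suc n) = cong (_+ 0ℚ) (zeros n)

sumTo-+ : ∀ n (f g : ℕ → ℚ) → sumTo n (λ i → f i + g i) ≡ sumTo n f + sumTo n g
sumTo-+ zero f g = refl
sumTo-+ (suc n) f g = begin
  sumTo n (λ i → f i + g i) + (f (suc n) + g (suc n))
    ≡⟨ cong (_+ (f (suc n) + g (suc n))) (sumTo-+ n f g) ⟩
  sumTo n f + sumTo n g + (f (suc n) + g (suc n))
    ≡⟨ solve 4 (λ a b c d → (a :+ b) :+ (c :+ d) := (a :+ c) :+ (b :+ d)) refl (sumTo n f) (sumTo n g) (f (suc n)) (g (suc n)) ⟩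
  sumTo n f + f (suc n) + (sumTo n g + g (suc n)) ∎

sumTo-neg : ∀ n (f : ℕ → ℚ) → sumTo n (λ i → - f i) ≡ - sumTo n f
sumTo-neg zero f = refl
sumTo-neg (suc n) f = trans (cong (_+ - f (suc n)) (sumTo-neg n f)) (sym (ℚP.neg-distrib-+ (sumTo n f) (f (suc n))))

*-distribˡ-sumTo : ∀ n c (f : ℕ → ℚ) → c * sumTo n f ≡ sumTo n (λ i → c * f i)
*-distribˡ-sumTo zero c f = refl
*-distribˡ-sumTo (suc n) c f = trans (ℚP.*-distribˡ-+ c (sumTo n f) (f (suc n))) (cong (_+ c * f (suc n)) (*-distribˡ-sumTo n c f))

*-distribʳ-sumTo : ∀ n c (f : ℕ → ℚ) → sumTo n f * c ≡ sumTo n (λ i → f i * c)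
*-distribʳ-sumTo n c f = trans (ℚP.*-comm _ c) (trans (*-distribˡ-sumTo n c f) (sumTo-cong n (λ i → ℚP.*-comm c (f i))))

sumTo-unfoldˡ : ∀ n (f : ℕ → ℚ) → sumTo (suc n) f ≡ f 0 + sumTo n (λ i → f (suc i))
sumTo-unfoldˡ zero f = refl
sumTo-unfoldˡ (suc n) f = trans (cong (_+ f (suc (suc n))) (sumTo-unfoldˡ n f)) (ℚP.+-assoc (f 0) _ _)

sumTo-swap : ∀ m n (f : ℕ → ℕ → ℚ) → sumTo m (λ i → sumTo n (f i)) ≡ sumTo n (λ j → sumTo m (λ i → f i j))
sumTo-swap zero n f = refl
sumTo-swap (suc m) n f = trans (cong (_+ sumTo n (f (suc m))) (sumTo-swap m n f)) (sym (sumTo-+ n _ (f (suc m))))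

sumTo-extend : ∀ {m n} (f : ℕ → ℚ) → m ≤ n → (∀ i → m < i → f i ≡ 0ℚ) → sumTo n f ≡ sumTo m f
sumTo-extend {m} {zero} f z≤n _ = refl
sumTo-extend {m} {suc n} f m≤1+n zeros with ℕP.m≤n⇒m<n∨m≡n m≤1+n
... | inj₁ m<1+n = trans (cong₂ _+_ (sumTo-extend f (ℕP.≤-pred m<1+n) zeros) (zeros (suc n) m<1+n)) (ℚP.+-identityʳ _)
... | inj₂ refl = refl

sumTo-last : ∀ n (f : ℕ → ℚ) → (∀ i → i < n → f i ≡ 0ℚ) → sumTo n f ≡ f n
sumTo-last zero f _ = refl
sumTo-last (suc n) f zeros = trans (cong (_+ f (suc n)) (sumTo-zero n (λ i i≤n → zeros i (s≤s i≤n)))) (ℚP.+-identityˡ _)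

sumTo-first : ∀ n (f : ℕ → ℚ) → (∀ i → f (suc i) ≡ 0ℚ) → sumTo n f ≡ f 0
sumTo-first zero f _ = refl
sumTo-first (suc n) f zeros = trans (sumTo-unfoldˡ n f) (trans (cong (λ u → f 0 + u) (sumTo-zero n (λ i _ → zeros i))) (ℚP.+-identityʳ _))

-- Formal power series in x and t

infix 4 _≈_
_≈_ : Ser → Ser → Set
F ≈ G = ∀ a b → F a b ≡ G a b

≈-refl : ∀ {F} → F ≈ F
≈-refl a b = refl

≈-sym : ∀ {F G} → F ≈ G → G ≈ F
≈-sym F≈G a b = sym (F≈G a b)

≈-trans : ∀ {F G H} → F ≈ G → G ≈ H → F ≈ H
≈-trans F≈G G≈H a b = trans (F≈G a b) (G≈H a b)

infixl 6 _⊕_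
_⊕_ : Ser → Ser → Ser
(F ⊕ G) a b = F a b + G a b

infixr 7 _·_
_·_ : ℚ → Ser → Ser
(c · F) a b = c * F a b

zeroS : Ser
zeroS _ _ = 0ℚ

mulX : Ser → Ser
mulX F zero b = 0ℚ
mulX F (suc a) b = F a b

mulT : Ser → Ser
mulT F a zero = 0ℚ
mulT F a (suc b) = F a b

mulXT : Ser → Ser
mulXT F = mulX (mulT F)

mulT² : Ser → Ser
mulT² F = mulT (mulT F)

weightBy : (ℕ → ℕ → ℚ) → Ser → Ser
weightBy w F a b = w a b * F a b

-- The Euler operators t ∂/∂t and x ∂/∂x.
θₜ : Ser → Ser
θₜ = weightBy (λ _ b → ι b)

θₓ : Ser → Ser
θₓ = weightBy (λ a _ → ι a)

⊕-cong : ∀ {F F′ G G′} → F ≈ F′ → G ≈ G′ → F ⊕ G ≈ F′ ⊕ G′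
⊕-cong F≈F′ G≈G′ a b = cong₂ _+_ (F≈F′ a b) (G≈G′ a b)

·-cong : ∀ c {F G} → F ≈ G → c · F ≈ c · G
·-cong c F≈G a b = cong (c *_) (F≈G a b)

mulX-cong : ∀ {F G} → F ≈ G → mulX F ≈ mulX G
mulX-cong F≈G zero b = refl
mulX-cong F≈G (suc a) b = F≈G a b

mulT-cong : ∀ {F G} → F ≈ G → mulT F ≈ mulT G
mulT-cong F≈G a zero = refl
mulT-cong F≈G a (suc b) = F≈G a b

mulX-⊕ : ∀ F G → mulX (F ⊕ G) ≈ mulX F ⊕ mulX G
mulX-⊕ F G zero b = sym (ℚP.+-identityʳ 0ℚ)
mulX-⊕ F G (suc a) b = refl

mulT-⊕ : ∀ F G → mulT (F ⊕ G) ≈ mulT F ⊕ mulT G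
mulT-⊕ F G a zero = sym (ℚP.+-identityʳ 0ℚ)
mulT-⊕ F G a (suc b) = refl

mulX-· : ∀ c F → mulX (c · F) ≈ c · mulX F
mulX-· c F zero b = sym (ℚP.*-zeroʳ c)
mulX-· c F (suc a) b = refl

mulT-· : ∀ c F → mulT (c · F) ≈ c · mulT F
mulT-· c F a zero = sym (ℚP.*-zeroʳ c)
mulT-· c F a (suc b) = refl

mulX-mulT-comm : ∀ F → mulX (mulT F) ≈ mulT (mulX F)
mulX-mulT-comm F zero zero = refl
mulX-mulT-comm F zero (suc b) = refl
mulX-mulT-comm F (suc a) zero = refl
mulX-mulT-comm F (suc a) (suc b) = refl

⊛-cong : ∀ {F F′ G G′} → F ≈ F′ → G ≈ G′ → F ⊛ G ≈ F′ ⊛ G′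
⊛-cong F≈F′ G≈G′ a b = sumTo-cong a (λ i → sumTo-cong b (λ j → cong₂ _*_ (F≈F′ i j) (G≈G′ (a ∸ i) (b ∸ j))))

⊛-distribˡ-⊕ : ∀ F G H → F ⊛ (G ⊕ H) ≈ F ⊛ G ⊕ F ⊛ H
⊛-distribˡ-⊕ F G H a b =
  trans (sumTo-cong a (λ i → trans (sumTo-cong b (λ j → ℚP.*-distribˡ-+ (F i j) _ _)) (sumTo-+ b _ _)))
        (sumTo-+ a _ _)

⊛-distribʳ-⊕ : ∀ F G H → (F ⊕ G) ⊛ H ≈ F ⊛ H ⊕ G ⊛ H
⊛-distribʳ-⊕ F G H a b =
  trans (sumTo-cong a (λ i → trans (sumTo-cong b (λ j → ℚP.*-distribʳ-+ (H (a ∸ i) (b ∸ j)) (F i j) (G i j))) (sumTo-+ b _ _)))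
        (sumTo-+ a _ _)

⊛-·ˡ : ∀ c F G → (c · F) ⊛ G ≈ c · (F ⊛ G)
⊛-·ˡ c F G a b = sym (trans (*-distribˡ-sumTo a c _) (sumTo-cong a (λ i → trans (*-distribˡ-sumTo b c _)
  (sumTo-cong b (λ j → sym (ℚP.*-assoc c (F i j) (G (a ∸ i) (b ∸ j))))))))

⊛-·ʳ : ∀ c F G → F ⊛ (c · G) ≈ c · (F ⊛ G)
⊛-·ʳ c F G a b = sym (trans (*-distribˡ-sumTo a c _) (sumTo-cong a (λ i → trans (*-distribˡ-sumTo b c _)
  (sumTo-cong b (λ j → solve 3 (λ c x y → c :* (x :* y) := x :* (c :* y)) refl c (F i j) (G (a ∸ i) (b ∸ j)))))))

⊛-zeroʳ : ∀ F → F ⊛ zeroS ≈ zeroS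
⊛-zeroʳ F a b = sumTo-zero a (λ i _ → sumTo-zero b (λ j _ → ℚP.*-zeroʳ (F i j)))

⊛-identityˡ : ∀ G → oneS ⊛ G ≈ G
⊛-identityˡ G a b = trans (sumTo-first a _ (λ i → sumTo-zero b (λ j _ → ℚP.*-zeroˡ (G (a ∸ suc i) (b ∸ j)))))
                   (trans (sumTo-first b _ (λ j → ℚP.*-zeroˡ (G a (b ∸ suc j)))) (ℚP.*-identityˡ (G a b)))

⊛-identityʳ : ∀ F → F ⊛ oneS ≈ F
⊛-identityʳ F a b = trans (sumTo-last a _ off-diagonal-row) (trans (sumTo-last b _ off-diagonal) diagonal)
  where
  off-diagonal : ∀ j → j < b → F a j * oneS (a ∸ a) (b ∸ j) ≡ 0ℚ
  off-diagonal j j<b rewrite ℕP.n∸n≡0 a | ℕP.+-∸-assoc 1 j<b = ℚP.*-zeroʳ (F a j)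
  off-diagonal-row : ∀ i → i < a → sumTo b (λ j → F i j * oneS (a ∸ i) (b ∸ j)) ≡ 0ℚ
  off-diagonal-row i i<a rewrite ℕP.+-∸-assoc 1 i<a = sumTo-zero b (λ j _ → ℚP.*-zeroʳ (F i j))
  diagonal : F a b * oneS (a ∸ a) (b ∸ b) ≡ F a b
  diagonal rewrite ℕP.n∸n≡0 a | ℕP.n∸n≡0 b = ℚP.*-identityʳ (F a b)

⊛-mulXˡ : ∀ F G → mulX F ⊛ G ≈ mulX (F ⊛ G)
⊛-mulXˡ F G zero b = sumTo-zero b (λ j _ → ℚP.*-zeroˡ (G 0 (b ∸ j)))
⊛-mulXˡ F G (suc a) b =
  trans (sumTo-unfoldˡ a _) (trans (cong (_+ (F ⊛ G) a b) (sumTo-zero b (λ j _ → ℚP.*-zeroˡ (G (suc a) (b ∸ j))))) (ℚP.+-identityˡ _))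

⊛-mulTˡ : ∀ F G → mulT F ⊛ G ≈ mulT (F ⊛ G)
⊛-mulTˡ F G a zero = sumTo-zero a (λ i _ → ℚP.*-zeroˡ (G (a ∸ i) 0))
⊛-mulTˡ F G a (suc b) = sumTo-cong a (λ i →
  trans (sumTo-unfoldˡ b _) (trans (cong (_+ sumTo b (λ j → F i j * G (a ∸ i) (b ∸ j))) (ℚP.*-zeroˡ (G (a ∸ i) (suc b)))) (ℚP.+-identityˡ _)))

⊛-mulXʳ : ∀ F G → F ⊛ mulX G ≈ mulX (F ⊛ G)
⊛-mulXʳ F G zero b = sumTo-zero b (λ j _ → ℚP.*-zeroʳ (F 0 j))
⊛-mulXʳ F G (suc a) b =
  trans (cong₂ _+_ (sumTo-cong-≤ a (λ i i≤a → sumTo-cong b (λ j → cong (λ u → F i j * mulX G u (b ∸ j)) (ℕP.+-∸-assoc 1 i≤a))))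
                   (sumTo-zero b (λ j _ → trans (cong (λ u → F (suc a) j * mulX G u (b ∸ j)) (ℕP.n∸n≡0 a)) (ℚP.*-zeroʳ (F (suc a) j)))))
        (ℚP.+-identityʳ _)

⊛-mulTʳ : ∀ F G → F ⊛ mulT G ≈ mulT (F ⊛ G)
⊛-mulTʳ F G a zero = sumTo-zero a (λ i _ → ℚP.*-zeroʳ (F i 0))
⊛-mulTʳ F G a (suc b) = sumTo-cong a (λ i →
  trans (cong₂ _+_ (sumTo-cong-≤ b (λ j j≤b → cong (λ u → F i j * mulT G (a ∸ i) u) (ℕP.+-∸-assoc 1 j≤b)))
                   (trans (cong (λ u → F i (suc b) * mulT G (a ∸ i) u) (ℕP.n∸n≡0 b)) (ℚP.*-zeroʳ (F i (suc b)))))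
        (ℚP.+-identityʳ _))

⊛-mulXTˡ : ∀ F G → mulXT F ⊛ G ≈ mulXT (F ⊛ G)
⊛-mulXTˡ F G = ≈-trans (⊛-mulXˡ (mulT F) G) (mulX-cong (⊛-mulTˡ F G))

⊛-mulT²ˡ : ∀ F G → mulT² F ⊛ G ≈ mulT² (F ⊛ G)
⊛-mulT²ˡ F G = ≈-trans (⊛-mulTˡ (mulT F) G) (mulT-cong (⊛-mulTˡ F G))

⊛-mulXTʳ : ∀ F G → F ⊛ mulXT G ≈ mulXT (F ⊛ G)
⊛-mulXTʳ F G = ≈-trans (⊛-mulXʳ F (mulT G)) (mulX-cong (⊛-mulTʳ F G))

⊛-mulT²ʳ : ∀ F G → F ⊛ mulT² G ≈ mulT² (F ⊛ G)
⊛-mulT²ʳ F G = ≈-trans (⊛-mulTʳ F (mulT G)) (mulT-cong (⊛-mulTʳ F G))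

Additive : (ℕ → ℕ → ℚ) → Set
Additive w = ∀ {a b i j} → i ≤ a → j ≤ b → w a b ≡ w i j + w (a ∸ i) (b ∸ j)

weightBy-⊛ : ∀ {w} → Additive w → ∀ F G → weightBy w (F ⊛ G) ≈ weightBy w F ⊛ G ⊕ F ⊛ weightBy w G
weightBy-⊛ {w} additive F G a b = begin
  w a b * (F ⊛ G) a b
    ≡⟨ trans (*-distribˡ-sumTo a (w a b) _) (sumTo-cong a (λ i → *-distribˡ-sumTo b (w a b) _)) ⟩
  sumTo a (λ i → sumTo b (λ j → w a b * (F i j * G (a ∸ i) (b ∸ j))))
    ≡⟨ sumTo-cong-≤ a (λ i i≤a → trans (sumTo-cong-≤ b (λ j j≤b → split i≤a j≤b)) (sumTo-+ b _ _)) ⟩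
  sumTo a (λ i → sumTo b (λ j → (w i j * F i j) * G (a ∸ i) (b ∸ j)) + sumTo b (λ j → F i j * (w (a ∸ i) (b ∸ j) * G (a ∸ i) (b ∸ j))))
    ≡⟨ sumTo-+ a _ _ ⟩
  (weightBy w F ⊛ G ⊕ F ⊛ weightBy w G) a b ∎
  where
  split : ∀ {i j} → i ≤ a → j ≤ b →
    w a b * (F i j * G (a ∸ i) (b ∸ j)) ≡ (w i j * F i j) * G (a ∸ i) (b ∸ j) + F i j * (w (a ∸ i) (b ∸ j) * G (a ∸ i) (b ∸ j))
  split {i} {j} i≤a j≤b = begin
    w a b * (F i j * G (a ∸ i) (b ∸ j))   ≡⟨ cong (_* (F i j * G (a ∸ i) (b ∸ j))) (additive i≤a j≤b) ⟩
    (w i j + w (a ∸ i) (b ∸ j)) * (F i j * G (a ∸ i) (b ∸ j))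
      ≡⟨ solve 4 (λ u v x y → (u :+ v) :* (x :* y) := (u :* x) :* y :+ x :* (v :* y)) refl (w i j) (w (a ∸ i) (b ∸ j)) (F i j) (G (a ∸ i) (b ∸ j)) ⟩
    (w i j * F i j) * G (a ∸ i) (b ∸ j) + F i j * (w (a ∸ i) (b ∸ j) * G (a ∸ i) (b ∸ j)) ∎

θₜ-⊛ : ∀ F G → θₜ (F ⊛ G) ≈ θₜ F ⊛ G ⊕ F ⊛ θₜ G
θₜ-⊛ = weightBy-⊛ (λ _ j≤b → ι-additive j≤b)

mulXT-· : ∀ c F → mulXT (c · F) ≈ c · mulXT F
mulXT-· c F = ≈-trans (mulX-cong (mulT-· c F)) (mulX-· c (mulT F))

mulT²-· : ∀ c F → mulT² (c · F) ≈ c · mulT² F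
mulT²-· c F = ≈-trans (mulT-cong (mulT-· c F)) (mulT-· c (mulT F))

mulForm : ℚ → ℚ → Ser → Ser
mulForm c d F = c · mulXT F ⊕ d · mulT² F

mulForm-cong : ∀ c d {F G} → F ≈ G → mulForm c d F ≈ mulForm c d G
mulForm-cong c d F≈G = ⊕-cong (·-cong c (mulX-cong (mulT-cong F≈G))) (·-cong d (mulT-cong (mulT-cong F≈G)))

mulForm-· : ∀ c d e F → mulForm c d (e · F) ≈ e · mulForm c d F
mulForm-· c d e F a b = begin
  c * mulXT (e · F) a b + d * mulT² (e · F) a b
    ≡⟨ cong₂ (λ u v → c * u + d * v) (mulXT-· e F a b) (mulT²-· e F a b) ⟩
  c * (e * mulXT F a b) + d * (e * mulT² F a b)
    ≡⟨ solve 5 (λ c d e x y → c :* (e :* x) :+ d :* (e :* y) := e :* (c :* x :+ d :* y)) refl c d e (mulXT F a b) (mulT² F a b) ⟩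
  e * (c * mulXT F a b + d * mulT² F a b) ∎

⊛-mulFormˡ : ∀ c d F G → mulForm c d F ⊛ G ≈ mulForm c d (F ⊛ G)
⊛-mulFormˡ c d F G =
  ≈-trans (⊛-distribʳ-⊕ (c · mulXT F) (d · mulT² F) G)
  (⊕-cong (≈-trans (⊛-·ˡ c (mulXT F) G) (·-cong c (⊛-mulXTˡ F G)))
          (≈-trans (⊛-·ˡ d (mulT² F) G) (·-cong d (⊛-mulT²ˡ F G))))

⊛-mulFormʳ : ∀ c d F G → F ⊛ mulForm c d G ≈ mulForm c d (F ⊛ G)
⊛-mulFormʳ c d F G =
  ≈-trans (⊛-distribˡ-⊕ F (c · mulXT G) (d · mulT² G))
  (⊕-cong (≈-trans (⊛-·ʳ c F (mulXT G)) (·-cong c (⊛-mulXTʳ F G)))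
          (≈-trans (⊛-·ʳ d F (mulT² G)) (·-cong d (⊛-mulT²ʳ F G))))

ΣS : ℕ → (ℕ → Ser) → Ser
ΣS N F a b = sumTo N (λ k → F k a b)

ΣS-cong : ∀ N {F G : ℕ → Ser} → (∀ k → F k ≈ G k) → ΣS N F ≈ ΣS N G
ΣS-cong N F≈G a b = sumTo-cong N (λ k → F≈G k a b)

ΣS-⊕ : ∀ N (F G : ℕ → Ser) → ΣS N (λ k → F k ⊕ G k) ≈ ΣS N F ⊕ ΣS N G
ΣS-⊕ N F G a b = sumTo-+ N (λ k → F k a b) (λ k → G k a b)

·-ΣS : ∀ c N (F : ℕ → Ser) → c · ΣS N F ≈ ΣS N (λ k → c · F k)
·-ΣS c N F a b = *-distribˡ-sumTo N c (λ k → F k a b)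

weightBy-ΣS : ∀ w N (F : ℕ → Ser) → weightBy w (ΣS N F) ≈ ΣS N (λ k → weightBy w (F k))
weightBy-ΣS w N F a b = *-distribˡ-sumTo N (w a b) (λ k → F k a b)

mulX-ΣS : ∀ N (F : ℕ → Ser) → mulX (ΣS N F) ≈ ΣS N (λ k → mulX (F k))
mulX-ΣS N F zero b = sym (sumTo-zero N (λ _ _ → refl))
mulX-ΣS N F (suc a) b = refl

mulT-ΣS : ∀ N (F : ℕ → Ser) → mulT (ΣS N F) ≈ ΣS N (λ k → mulT (F k))
mulT-ΣS N F a zero = sym (sumTo-zero N (λ _ _ → refl))
mulT-ΣS N F a (suc b) = refl

mulForm-ΣS : ∀ c d N (F : ℕ → Ser) → mulForm c d (ΣS N F) ≈ ΣS N (λ k → mulForm c d (F k))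
mulForm-ΣS c d N F = ≈-trans
  (⊕-cong (≈-trans (·-cong c (≈-trans (mulX-cong (mulT-ΣS N F)) (mulX-ΣS N (λ k → mulT (F k))))) (·-ΣS c N _))
          (≈-trans (·-cong d (≈-trans (mulT-cong (mulT-ΣS N F)) (mulT-ΣS N (λ k → mulT (F k))))) (·-ΣS d N _)))
  (≈-sym (ΣS-⊕ N _ _))

⊛-ΣS : ∀ H N (F : ℕ → Ser) → H ⊛ ΣS N F ≈ ΣS N (λ n → H ⊛ F n)
⊛-ΣS H N F a b = begin
  sumTo a (λ i → sumTo b (λ j → H i j * sumTo N (λ n → F n (a ∸ i) (b ∸ j))))
    ≡⟨ sumTo-cong a (λ i → sumTo-cong b (λ j → *-distribˡ-sumTo N (H i j) _)) ⟩
  sumTo a (λ i → sumTo b (λ j → sumTo N (λ n → H i j * F n (a ∸ i) (b ∸ j))))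
    ≡⟨ sumTo-cong a (λ i → sumTo-swap b N _) ⟩
  sumTo a (λ i → sumTo N (λ n → sumTo b (λ j → H i j * F n (a ∸ i) (b ∸ j))))
    ≡⟨ sumTo-swap a N _ ⟩
  ΣS N (λ n → H ⊛ F n) a b ∎

⊛-congʳ-upTo : ∀ H {F G} N → (∀ a b → b ≤ N → F a b ≡ G a b) → ∀ a → (H ⊛ F) a N ≡ (H ⊛ G) a N
⊛-congʳ-upTo H N F≡G a = sumTo-cong a (λ i → sumTo-cong-≤ N (λ j _ → cong (H i j *_) (F≡G (a ∸ i) (N ∸ j) (ℕP.m∸n≤m N j))))

mulTⁿ : ℕ → Ser → Ser
mulTⁿ zero F = F
mulTⁿ (suc n) F = mulT (mulTⁿ n F)

mulTⁿ-cong : ∀ n {F G} → F ≈ G → mulTⁿ n F ≈ mulTⁿ n G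
mulTⁿ-cong zero F≈G = F≈G
mulTⁿ-cong (suc n) F≈G = mulT-cong (mulTⁿ-cong n F≈G)

mulTⁿ-⊕ : ∀ n F G → mulTⁿ n (F ⊕ G) ≈ mulTⁿ n F ⊕ mulTⁿ n G
mulTⁿ-⊕ zero F G = ≈-refl
mulTⁿ-⊕ (suc n) F G = ≈-trans (mulT-cong (mulTⁿ-⊕ n F G)) (mulT-⊕ (mulTⁿ n F) (mulTⁿ n G))

mulTⁿ-· : ∀ n c F → mulTⁿ n (c · F) ≈ c · mulTⁿ n F
mulTⁿ-· zero c F = ≈-refl
mulTⁿ-· (suc n) c F = ≈-trans (mulT-cong (mulTⁿ-· n c F)) (mulT-· c (mulTⁿ n F))

mulTⁿ-mulX : ∀ n F → mulTⁿ n (mulX F) ≈ mulX (mulTⁿ n F)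
mulTⁿ-mulX zero F = ≈-refl
mulTⁿ-mulX (suc n) F = ≈-trans (mulT-cong (mulTⁿ-mulX n F)) (≈-sym (mulX-mulT-comm (mulTⁿ n F)))

mulTⁿ-mulT : ∀ n F → mulTⁿ n (mulT F) ≈ mulT (mulTⁿ n F)
mulTⁿ-mulT zero F = ≈-refl
mulTⁿ-mulT (suc n) F = mulT-cong (mulTⁿ-mulT n F)

θₜ-mulT : ∀ F → θₜ (mulT F) ≈ mulT F ⊕ mulT (θₜ F)
θₜ-mulT F a zero = refl
θₜ-mulT F a (suc b) = begin
  ι (suc b) * F a b             ≡⟨ cong (_* F a b) (ι-+ 1 b) ⟩
  (1ℚ + ι b) * F a b            ≡⟨ ℚP.*-distribʳ-+ (F a b) 1ℚ (ι b) ⟩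
  1ℚ * F a b + ι b * F a b      ≡⟨ cong (_+ ι b * F a b) (ℚP.*-identityˡ (F a b)) ⟩
  F a b + ι b * F a b           ∎

θₜ-mulTⁿ : ∀ n F → θₜ (mulTⁿ n F) ≈ ι n · mulTⁿ n F ⊕ mulTⁿ n (θₜ F)
θₜ-mulTⁿ zero F a b = sym (trans (cong (_+ θₜ F a b) (ℚP.*-zeroˡ (F a b))) (ℚP.+-identityˡ _))
θₜ-mulTⁿ (suc n) F a b = begin
  θₜ (mulT G) a b                                          ≡⟨ θₜ-mulT G a b ⟩
  mulT G a b + mulT (θₜ G) a b                             ≡⟨ cong (mulT G a b +_) (mulT-cong (θₜ-mulTⁿ n F) a b) ⟩
  mulT G a b + mulT (ι n · G ⊕ mulTⁿ n (θₜ F)) a b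
    ≡⟨ cong (mulT G a b +_) (trans (mulT-⊕ (ι n · G) _ a b) (cong (_+ mulTⁿ (suc n) (θₜ F) a b) (mulT-· (ι n) G a b))) ⟩
  mulT G a b + (ι n * mulT G a b + mulTⁿ (suc n) (θₜ F) a b)
    ≡⟨ solve 3 (λ x i y → x :+ (i :* x :+ y) := (con 1ℚ :+ i) :* x :+ y) refl (mulT G a b) (ι n) _ ⟩
  (1ℚ + ι n) * mulT G a b + mulTⁿ (suc n) (θₜ F) a b       ≡⟨ cong (λ u → u * mulT G a b + mulTⁿ (suc n) (θₜ F) a b) (ι-+ 1 n) ⟨
  ι (suc n) * mulT G a b + mulTⁿ (suc n) (θₜ F) a b        ∎
  where G = mulTⁿ n F

mulTⁿ-apply : ∀ n F a s → mulTⁿ n F a (n ℕ.+ s) ≡ F a s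
mulTⁿ-apply zero F a s = refl
mulTⁿ-apply (suc n) F a s = mulTⁿ-apply n F a s

mulTⁿ-vanishes : ∀ n F a {b} → b < n → mulTⁿ n F a b ≡ 0ℚ
mulTⁿ-vanishes (suc n) F a {zero} _ = refl
mulTⁿ-vanishes (suc n) F a {suc b} (s≤s b<n) = mulTⁿ-vanishes n F a b<n

-- The generating function e^{2xt − t²}

gen≈mulForm : gen ≈ mulForm (ι 2) (- 1ℚ) oneS
gen≈mulForm zero zero = refl
gen≈mulForm zero (suc zero) = refl
gen≈mulForm zero (suc (suc zero)) = refl
gen≈mulForm zero (suc (suc (suc b))) = refl
gen≈mulForm (suc zero) zero = refl
gen≈mulForm (suc zero) (suc zero) = refl
gen≈mulForm (suc zero) (suc (suc zero)) = refl
gen≈mulForm (suc zero) (suc (suc (suc b))) = refl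
gen≈mulForm (suc (suc a)) zero = refl
gen≈mulForm (suc (suc a)) (suc zero) = refl
gen≈mulForm (suc (suc a)) (suc (suc zero)) = refl
gen≈mulForm (suc (suc a)) (suc (suc (suc b))) = refl

gen-⊛ : ∀ F → gen ⊛ F ≈ mulForm (ι 2) (- 1ℚ) F
gen-⊛ F = ≈-trans (⊛-cong gen≈mulForm (≈-refl {F}))
  (≈-trans (⊛-mulFormˡ (ι 2) (- 1ℚ) oneS F) (mulForm-cong (ι 2) (- 1ℚ) (⊛-identityˡ F)))

θₜ-gen : θₜ gen ≈ mulForm (ι 2) (- ι 2) oneS
θₜ-gen zero zero = refl
θₜ-gen zero (suc zero) = refl
θₜ-gen zero (suc (suc zero)) = refl
θₜ-gen zero (suc (suc (suc b))) = ℚP.*-zeroʳ (ι (suc (suc (suc b))))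
θₜ-gen (suc zero) zero = refl
θₜ-gen (suc zero) (suc zero) = refl
θₜ-gen (suc zero) (suc (suc zero)) = refl
θₜ-gen (suc zero) (suc (suc (suc b))) = ℚP.*-zeroʳ (ι (suc (suc (suc b))))
θₜ-gen (suc (suc a)) zero = refl
θₜ-gen (suc (suc a)) (suc zero) = refl
θₜ-gen (suc (suc a)) (suc (suc zero)) = refl
θₜ-gen (suc (suc a)) (suc (suc (suc b))) = ℚP.*-zeroʳ (ι (suc (suc (suc b))))

θₓ-gen : θₓ gen ≈ mulForm (ι 2) 0ℚ oneS
θₓ-gen zero zero = refl
θₓ-gen zero (suc zero) = refl
θₓ-gen zero (suc (suc zero)) = refl
θₓ-gen zero (suc (suc (suc b))) = refl
θₓ-gen (suc zero) zero = refl
θₓ-gen (suc zero) (suc zero) = refl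
θₓ-gen (suc zero) (suc (suc b)) = refl
θₓ-gen (suc (suc a)) zero = ℚP.*-zeroʳ (ι (suc (suc a)))
θₓ-gen (suc (suc a)) (suc zero) = ℚP.*-zeroʳ (ι (suc (suc a)))
θₓ-gen (suc (suc a)) (suc (suc b)) = ℚP.*-zeroʳ (ι (suc (suc a)))

AgreeBelow : ℕ → Ser → Ser → Set
AgreeBelow n F G = ∀ a b → a ℕ.+ b < n → F a b ≡ G a b

mulXT-congBelow : ∀ {n F G} → AgreeBelow n F G → AgreeBelow (2 ℕ.+ n) (mulXT F) (mulXT G)
mulXT-congBelow F≈G zero b _ = refl
mulXT-congBelow F≈G (suc a) zero _ = refl
mulXT-congBelow {n} F≈G (suc a) (suc b) (s≤s (s≤s a+1+b<n)) = F≈G a b (subst (_≤ n) (ℕP.+-suc a b) a+1+b<n)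

mulT²-congBelow : ∀ {n F G} → AgreeBelow n F G → AgreeBelow (2 ℕ.+ n) (mulT² F) (mulT² G)
mulT²-congBelow F≈G a zero _ = refl
mulT²-congBelow F≈G a (suc zero) _ = refl
mulT²-congBelow {n} F≈G a (suc (suc b)) a+2+b<2+n =
  F≈G a b (ℕP.+-cancelˡ-< 2 (a ℕ.+ b) n (subst (_< 2 ℕ.+ n) (trans (ℕP.+-suc a (suc b)) (cong suc (ℕP.+-suc a b))) a+2+b<2+n))

mulForm-congBelow : ∀ c d {n F G} → AgreeBelow n F G → AgreeBelow (2 ℕ.+ n) (mulForm c d F) (mulForm c d G)
mulForm-congBelow c d F≈G a b lt = cong₂ (λ u v → c * u + d * v) (mulXT-congBelow F≈G a b lt) (mulT²-congBelow F≈G a b lt)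

mulForm-zero : ∀ c d → mulForm c d zeroS ≈ zeroS
mulForm-zero c d a b = trans (cong₂ _+_ (cong (c *_) (mulXT-zero a b)) (cong (d *_) (mulT²-zero a b)))
  (trans (cong₂ _+_ (ℚP.*-zeroʳ c) (ℚP.*-zeroʳ d)) (ℚP.+-identityʳ 0ℚ))
  where
  mulXT-zero : mulXT zeroS ≈ zeroS
  mulXT-zero zero b = refl
  mulXT-zero (suc a) zero = refl
  mulXT-zero (suc a) (suc b) = refl
  mulT²-zero : mulT² zeroS ≈ zeroS
  mulT²-zero a zero = refl
  mulT²-zero a (suc zero) = refl
  mulT²-zero a (suc (suc b)) = refl

powS-gen-vanishesBelow : ∀ k → AgreeBelow (k ℕ.+ k) (powS gen k) zeroS
powS-gen-vanishesBelow zero a b ()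
powS-gen-vanishesBelow (suc k) a b lt = begin
  powS gen (suc k) a b               ≡⟨ gen-⊛ (powS gen k) a b ⟩
  mulForm (ι 2) (- 1ℚ) (powS gen k) a b
    ≡⟨ mulForm-congBelow (ι 2) (- 1ℚ) (powS-gen-vanishesBelow k) a b (subst (a ℕ.+ b <_) (ℕP.+-suc (suc k) k) lt) ⟩
  mulForm (ι 2) (- 1ℚ) zeroS a b     ≡⟨ mulForm-zero (ι 2) (- 1ℚ) a b ⟩
  0ℚ                                 ∎

expS≤ : ℕ → Ser → Ser
expS≤ N F = ΣS N (λ k → invFact k · powS F k)

expS≤-gen : ∀ {N a b} → a ℕ.+ b ≤ N → expS≤ N gen a b ≡ hermiteGF a b
expS≤-gen {N} {a} {b} a+b≤N = begin
  sumTo N (λ k → invFact k * powS gen k a b)         ≡⟨ sumTo-extend _ a+b≤N higher-terms-vanish ⟩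
  sumTo (a ℕ.+ b) (λ k → invFact k * powS gen k a b) ≡⟨ sumTo-cong (a ℕ.+ b) (λ k → ℚP.*-comm (invFact k) _) ⟩
  hermiteGF a b                                      ∎
  where
  higher-terms-vanish : ∀ k → a ℕ.+ b < k → invFact k * powS gen k a b ≡ 0ℚ
  higher-terms-vanish k a+b<k =
    trans (cong (invFact k *_) (powS-gen-vanishesBelow k a b (ℕP.<-≤-trans a+b<k (ℕP.m≤m+n k k)))) (ℚP.*-zeroʳ (invFact k))

mulForm-expS≤-gen : ∀ c d {N} a b → a ℕ.+ b ≤ N → mulForm c d (expS≤ N gen) a b ≡ mulForm c d hermiteGF a b
mulForm-expS≤-gen c d a b a+b≤N =
  mulForm-congBelow c d (λ i j i+j<1+N → expS≤-gen (ℕP.≤-pred i+j<1+N)) a b (ℕP.≤-trans (s≤s a+b≤N) (ℕP.m≤n+m _ 2))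

-- An additive weight w makes weightBy w a derivation. If it maps 2xt − t² to the
-- form q, it maps (2xt − t²)^(k+1) to (k + 1)·q·(2xt − t²)^k, hence e^{2xt − t²}
-- to q·e^{2xt − t²}.
module _ {w : ℕ → ℕ → ℚ} (additive : Additive w) (w₀₀≡0 : w 0 0 ≡ 0ℚ) {c d : ℚ} (w-gen : weightBy w gen ≈ mulForm c d oneS) where

  weightBy-oneS : weightBy w oneS ≈ zeroS
  weightBy-oneS zero zero = cong (_* 1ℚ) w₀₀≡0
  weightBy-oneS zero (suc b) = ℚP.*-zeroʳ (w 0 (suc b))
  weightBy-oneS (suc a) b = ℚP.*-zeroʳ (w (suc a) b)

  weightBy-powS-gen : ∀ k → weightBy w (powS gen (suc k)) ≈ ι (suc k) · mulForm c d (powS gen k)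
  weightBy-powS-gen k a b = begin
    weightBy w (gen ⊛ powS gen k) a b                           ≡⟨ weightBy-⊛ additive gen (powS gen k) a b ⟩
    (weightBy w gen ⊛ powS gen k) a b + (gen ⊛ weightBy w (powS gen k)) a b
      ≡⟨ cong₂ _+_ (weightBy-gen-⊛ a b) (gen-⊛-weightBy k a b) ⟩
    x + ι k * x                                                 ≡⟨ cong (_+ ι k * x) (ℚP.*-identityˡ x) ⟨
    1ℚ * x + ι k * x                                            ≡⟨ ℚP.*-distribʳ-+ x 1ℚ (ι k) ⟨
    (1ℚ + ι k) * x                                              ≡⟨ cong (_* x) (ι-+ 1 k) ⟨
    ι (suc k) * x                                               ∎
    where
    x = mulForm c d (powS gen k) a b
    weightBy-gen-⊛ : weightBy w gen ⊛ powS gen k ≈ mulForm c d (powS gen k)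
    weightBy-gen-⊛ = ≈-trans (⊛-cong w-gen (≈-refl {powS gen k}))
      (≈-trans (⊛-mulFormˡ c d oneS (powS gen k)) (mulForm-cong c d (⊛-identityˡ (powS gen k))))
    gen-⊛-weightBy : ∀ k → gen ⊛ weightBy w (powS gen k) ≈ ι k · mulForm c d (powS gen k)
    gen-⊛-weightBy zero = ≈-trans (⊛-cong (≈-refl {gen}) weightBy-oneS) (≈-trans (⊛-zeroʳ gen) (λ a b → sym (ℚP.*-zeroˡ (mulForm c d oneS a b))))
    gen-⊛-weightBy (suc k) = ≈-trans (⊛-cong (≈-refl {gen}) (weightBy-powS-gen k))
      (≈-trans (⊛-·ʳ (ι (suc k)) gen (mulForm c d (powS gen k))) (·-cong (ι (suc k)) (⊛-mulFormʳ c d gen (powS gen k))))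

  weightBy-hermiteGF : weightBy w hermiteGF ≈ mulForm c d hermiteGF
  weightBy-hermiteGF a b = begin
    w a b * hermiteGF a b
      ≡⟨ cong (w a b *_) (expS≤-gen (ℕP.n≤1+n M)) ⟨
    weightBy w (expS≤ (suc M) gen) a b
      ≡⟨ weightBy-ΣS w (suc M) (λ k → invFact k · powS gen k) a b ⟩
    sumTo (suc M) (λ k → w a b * (invFact k * powS gen k a b))
      ≡⟨ sumTo-unfoldˡ M _ ⟩
    w a b * (invFact 0 * oneS a b) + sumTo M (λ k → w a b * (invFact (suc k) * powS gen (suc k) a b))
      ≡⟨ cong₂ _+_ constant-term (sumTo-cong M higher-term) ⟩
    0ℚ + ΣS M (λ k → invFact k · mulForm c d (powS gen k)) a b
      ≡⟨ ℚP.+-identityˡ _ ⟩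
    ΣS M (λ k → invFact k · mulForm c d (powS gen k)) a b
      ≡⟨ ΣS-cong M (λ k → ≈-sym (mulForm-· c d (invFact k) (powS gen k))) a b ⟩
    ΣS M (λ k → mulForm c d (invFact k · powS gen k)) a b
      ≡⟨ mulForm-ΣS c d M _ a b ⟨
    mulForm c d (expS≤ M gen) a b
      ≡⟨ mulForm-expS≤-gen c d a b ℕP.≤-refl ⟩
    mulForm c d hermiteGF a b ∎
    where
    M = a ℕ.+ b
    commute : ∀ x y z → x * (y * z) ≡ y * (x * z)
    commute = solve 3 (λ x y z → x :* (y :* z) := y :* (x :* z)) refl
    constant-term : w a b * (invFact 0 * oneS a b) ≡ 0ℚ
    constant-term = trans (commute (w a b) (invFact 0) (oneS a b)) (trans (cong (invFact 0 *_) (weightBy-oneS a b)) (ℚP.*-zeroʳ (invFact 0)))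
    higher-term : ∀ k → w a b * (invFact (suc k) * powS gen (suc k) a b) ≡ invFact k * mulForm c d (powS gen k) a b
    higher-term k = begin
      w a b * (invFact (suc k) * powS gen (suc k) a b)         ≡⟨ commute (w a b) (invFact (suc k)) _ ⟩
      invFact (suc k) * (w a b * powS gen (suc k) a b)         ≡⟨ cong (invFact (suc k) *_) (weightBy-powS-gen k a b) ⟩
      invFact (suc k) * (ι (suc k) * mulForm c d (powS gen k) a b)
        ≡⟨ solve 3 (λ x y z → x :* (y :* z) := (y :* x) :* z) refl (invFact (suc k)) (ι (suc k)) _ ⟩
      ι (suc k) * invFact (suc k) * mulForm c d (powS gen k) a b ≡⟨ cong (_* mulForm c d (powS gen k) a b) (ι[1+k]*invFact[1+k]≡invFact[k] k) ⟩
      invFact k * mulForm c d (powS gen k) a b                 ∎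

θₜ-hermiteGF : θₜ hermiteGF ≈ mulForm (ι 2) (- ι 2) hermiteGF
θₜ-hermiteGF = weightBy-hermiteGF {w = λ _ b → ι b} (λ _ j≤b → ι-additive j≤b) refl {c = ι 2} {d = - ι 2} θₜ-gen

θₓ-hermiteGF : θₓ hermiteGF ≈ mulForm (ι 2) 0ℚ hermiteGF
θₓ-hermiteGF = weightBy-hermiteGF {w = λ a _ → ι a} (λ i≤a _ → ι-additive i≤a) refl {c = ι 2} {d = 0ℚ} θₓ-gen

-- Hermite polynomials and the substitution x ↦ x − t

Poly : Set
Poly = ℕ → ℚ

mulXₚ : Poly → Poly
mulXₚ f zero = 0ℚ
mulXₚ f (suc i) = f i

derivₚ : Poly → Poly
derivₚ f i = ι (suc i) * f (suc i)

-- hermitePoly k lists the coefficients of Hₖ(x)/k!, and hermitePolyPred k those of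
-- H_{k−1}(x)/(k−1)!, which is 0 for k = 0.
hermitePoly : ℕ → Poly
hermitePoly k i = hermiteGF i k

hermitePolyPred : ℕ → Poly
hermitePolyPred k i = mulT hermiteGF i k

hermitePoly-recurrence : ∀ k i → ι (suc k) * hermitePoly (suc k) i ≡ ι 2 * mulXₚ (hermitePoly k) i + - ι 2 * hermitePolyPred k i
hermitePoly-recurrence k zero = θₜ-hermiteGF zero (suc k)
hermitePoly-recurrence k (suc i) = θₜ-hermiteGF (suc i) (suc k)

derivₚ-hermitePoly : ∀ k i → derivₚ (hermitePoly k) i ≡ ι 2 * hermitePolyPred k i
derivₚ-hermitePoly k i = trans (θₓ-hermiteGF (suc i) k)
  (trans (cong (ι 2 * hermitePolyPred k i +_) (ℚP.*-zeroˡ (mulT² hermiteGF (suc i) k))) (ℚP.+-identityʳ _))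

hermitePoly-zero : ∀ i → hermitePoly 0 (suc i) ≡ 0ℚ
hermitePoly-zero i = ι-cancelˡ i (trans (derivₚ-hermitePoly 0 i) (trans (ℚP.*-zeroʳ (ι 2)) (sym (ℚP.*-zeroʳ (ι (suc i))))))

atXminusT : Poly → Ser
atXminusT f a s = f (a ℕ.+ s) * ι ((a ℕ.+ s) C s) * sgn s

atXminusT-cong : ∀ {f g} → (∀ i → f i ≡ g i) → atXminusT f ≈ atXminusT g
atXminusT-cong f≡g a s = cong (λ u → u * ι ((a ℕ.+ s) C s) * sgn s) (f≡g (a ℕ.+ s))

atXminusT-· : ∀ c f → atXminusT (λ i → c * f i) ≈ c · atXminusT f
atXminusT-· c f a s = solve 4 (λ c x b σ → (c :* x) :* b :* σ := c :* (x :* b :* σ)) refl c (f (a ℕ.+ s)) (ι ((a ℕ.+ s) C s)) (sgn s)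

atXminusT-linear : ∀ c d f g → atXminusT (λ i → c * f i + d * g i) ≈ c · atXminusT f ⊕ d · atXminusT g
atXminusT-linear c d f g a s =
  solve 6 (λ c d x y b σ → (c :* x :+ d :* y) :* b :* σ := c :* (x :* b :* σ) :+ d :* (y :* b :* σ)) refl
    c d (f (a ℕ.+ s)) (g (a ℕ.+ s)) (ι ((a ℕ.+ s) C s)) (sgn s)

atXminusT-mulXₚ : ∀ f → atXminusT (mulXₚ f) ≈ mulX (atXminusT f) ⊕ (- 1ℚ) · mulT (atXminusT f)
atXminusT-mulXₚ f zero zero = refl
atXminusT-mulXₚ f (suc a) zero = sym (ℚP.+-identityʳ _)
atXminusT-mulXₚ f zero (suc s) rewrite nCn≡1 s | nCn≡1 (suc s) =
  solve 2 (λ x σ → x :* con 1ℚ :* (:- σ) := con 0ℚ :+ (:- con 1ℚ) :* (x :* con 1ℚ :* σ)) refl (f s) (sgn s)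
atXminusT-mulXₚ f (suc a) (suc s) rewrite ℕP.+-suc a s | sym (nCk+nC[k+1]≡[n+1]C[k+1] (suc (a ℕ.+ s)) s) | ι-+ (suc (a ℕ.+ s) C s) (suc (a ℕ.+ s) C suc s) =
  solve 4 (λ x b c σ → x :* (b :+ c) :* (:- σ) := x :* c :* (:- σ) :+ (:- con 1ℚ) :* (x :* b :* σ)) refl
    (f (suc (a ℕ.+ s))) (ι (suc (a ℕ.+ s) C s)) (ι (suc (a ℕ.+ s) C suc s)) (sgn s)

θₜ-atXminusT : ∀ f → θₜ (atXminusT f) ≈ (- 1ℚ) · mulT (atXminusT (derivₚ f))
θₜ-atXminusT f a zero = ℚP.*-zeroˡ (atXminusT f a 0)
θₜ-atXminusT f a (suc s) rewrite ℕP.+-suc a s = begin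
  ι (suc s) * (f (suc n) * ι (suc n C suc s) * - sgn s)
    ≡⟨ solve 4 (λ i x b σ → i :* (x :* b :* (:- σ)) := (:- con 1ℚ) :* ((i :* b) :* x :* σ)) refl (ι (suc s)) (f (suc n)) (ι (suc n C suc s)) (sgn s) ⟩
  - 1ℚ * ((ι (suc s) * ι (suc n C suc s)) * f (suc n) * sgn s)
    ≡⟨ cong (λ u → - 1ℚ * (u * f (suc n) * sgn s)) absorb ⟩
  - 1ℚ * ((ι (suc n) * ι (n C s)) * f (suc n) * sgn s)
    ≡⟨ cong (- 1ℚ *_) (solve 4 (λ i b x σ → (i :* b) :* x :* σ := i :* x :* b :* σ) refl (ι (suc n)) (ι (n C s)) (f (suc n)) (sgn s)) ⟩
  - 1ℚ * (derivₚ f n * ι (n C s) * sgn s) ∎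
  where
  n = a ℕ.+ s
  absorb : ι (suc s) * ι (suc n C suc s) ≡ ι (suc n) * ι (n C s)
  absorb = trans (sym (ι-* (suc s) (suc n C suc s))) (trans (cong ι ([k+1]*[n+1]C[k+1]≡[n+1]*nCk n s)) (ι-* (suc n) (n C s)))

-- tᵏ Hₖ(x − t)/k! and t^(k+1) H_{k−1}(x − t)/(k−1)!.
shiftedHermite : ℕ → Ser
shiftedHermite k = mulTⁿ k (atXminusT (hermitePoly k))

shiftedHermitePred : ℕ → Ser
shiftedHermitePred k = mulTⁿ (suc k) (atXminusT (hermitePolyPred k))

atXminusT-hermitePoly-recurrence : ∀ k →
  ι (suc k) · atXminusT (hermitePoly (suc k)) ≈
  ι 2 · mulX (atXminusT (hermitePoly k)) ⊕ (- ι 2) · mulT (atXminusT (hermitePoly k)) ⊕ (- ι 2) · atXminusT (hermitePolyPred k)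
atXminusT-hermitePoly-recurrence k a s = begin
  ι (suc k) * atXminusT (hermitePoly (suc k)) a s
    ≡⟨ atXminusT-· (ι (suc k)) (hermitePoly (suc k)) a s ⟨
  atXminusT (λ i → ι (suc k) * hermitePoly (suc k) i) a s
    ≡⟨ atXminusT-cong (hermitePoly-recurrence k) a s ⟩
  atXminusT (λ i → ι 2 * mulXₚ (hermitePoly k) i + - ι 2 * hermitePolyPred k i) a s
    ≡⟨ atXminusT-linear (ι 2) (- ι 2) (mulXₚ (hermitePoly k)) (hermitePolyPred k) a s ⟩
  ι 2 * atXminusT (mulXₚ (hermitePoly k)) a s + - ι 2 * P
    ≡⟨ cong (λ u → ι 2 * u + - ι 2 * P) (atXminusT-mulXₚ (hermitePoly k) a s) ⟩
  ι 2 * (mulX S a s + - 1ℚ * mulT S a s) + - ι 2 * P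
    ≡⟨ solve 4 (λ x y p t → t :* (x :+ (:- con 1ℚ) :* y) :+ (:- t) :* p := t :* x :+ (:- t) :* y :+ (:- t) :* p) refl (mulX S a s) (mulT S a s) P (ι 2) ⟩
  ι 2 * mulX S a s + - ι 2 * mulT S a s + - ι 2 * P ∎
  where
  S = atXminusT (hermitePoly k)
  P = atXminusT (hermitePolyPred k) a s

θₜ-atXminusT-hermitePoly : ∀ k → θₜ (atXminusT (hermitePoly k)) ≈ (- ι 2) · mulT (atXminusT (hermitePolyPred k))
θₜ-atXminusT-hermitePoly k a s = begin
  θₜ (atXminusT (hermitePoly k)) a s                              ≡⟨ θₜ-atXminusT (hermitePoly k) a s ⟩
  - 1ℚ * mulT (atXminusT (derivₚ (hermitePoly k))) a s            ≡⟨ cong (- 1ℚ *_) (mulT-cong (atXminusT-cong (derivₚ-hermitePoly k)) a s) ⟩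
  - 1ℚ * mulT (atXminusT (λ i → ι 2 * hermitePolyPred k i)) a s   ≡⟨ cong (- 1ℚ *_) (mulT-cong (atXminusT-· (ι 2) (hermitePolyPred k)) a s) ⟩
  - 1ℚ * mulT (ι 2 · P) a s                                       ≡⟨ cong (- 1ℚ *_) (mulT-· (ι 2) P a s) ⟩
  - 1ℚ * (ι 2 * mulT P a s)                                       ≡⟨ solve 2 (λ t x → (:- con 1ℚ) :* (t :* x) := (:- t) :* x) refl (ι 2) (mulT P a s) ⟩
  - ι 2 * mulT P a s                                              ∎
  where P = atXminusT (hermitePolyPred k)

shiftedHermite-recurrence : ∀ k →
  ι (suc k) · shiftedHermite (suc k) ≈ mulForm (ι 2) (- ι 2) (shiftedHermite k) ⊕ (- ι 2) · shiftedHermitePred k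
shiftedHermite-recurrence k a b = begin
  ι (suc k) * mulTⁿ (suc k) (atXminusT (hermitePoly (suc k))) a b
    ≡⟨ mulTⁿ-· (suc k) (ι (suc k)) _ a b ⟨
  mulTⁿ (suc k) (ι (suc k) · atXminusT (hermitePoly (suc k))) a b
    ≡⟨ mulTⁿ-cong (suc k) (atXminusT-hermitePoly-recurrence k) a b ⟩
  mulTⁿ (suc k) (ι 2 · mulX S ⊕ (- ι 2) · mulT S ⊕ (- ι 2) · P) a b
    ≡⟨ trans (mulTⁿ-⊕ (suc k) (ι 2 · mulX S ⊕ (- ι 2) · mulT S) _ a b)
             (cong₂ _+_ (trans (mulTⁿ-⊕ (suc k) (ι 2 · mulX S) _ a b) (cong₂ _+_ (mulTⁿ-· (suc k) (ι 2) (mulX S) a b) (mulTⁿ-· (suc k) (- ι 2) (mulT S) a b)))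
                        (mulTⁿ-· (suc k) (- ι 2) P a b)) ⟩
  ι 2 * mulTⁿ (suc k) (mulX S) a b + - ι 2 * mulTⁿ (suc k) (mulT S) a b + - ι 2 * shiftedHermitePred k a b
    ≡⟨ cong₂ (λ u v → ι 2 * u + - ι 2 * v + - ι 2 * shiftedHermitePred k a b)
         (trans (mulT-cong (mulTⁿ-mulX k S) a b) (sym (mulX-mulT-comm (mulTⁿ k S) a b)))
         (mulT-cong (mulTⁿ-mulT k S) a b) ⟩
  ι 2 * mulXT (shiftedHermite k) a b + - ι 2 * mulT² (shiftedHermite k) a b + - ι 2 * shiftedHermitePred k a b ∎
  where
  S = atXminusT (hermitePoly k)
  P = atXminusT (hermitePolyPred k)

θₜ-shiftedHermite : ∀ k → θₜ (shiftedHermite k) ≈ ι k · shiftedHermite k ⊕ (- ι 2) · shiftedHermitePred k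
θₜ-shiftedHermite k a b = begin
  θₜ (mulTⁿ k S) a b                                        ≡⟨ θₜ-mulTⁿ k S a b ⟩
  ι k * shiftedHermite k a b + mulTⁿ k (θₜ S) a b           ≡⟨ cong (ι k * shiftedHermite k a b +_) (mulTⁿ-cong k (θₜ-atXminusT-hermitePoly k) a b) ⟩
  ι k * shiftedHermite k a b + mulTⁿ k ((- ι 2) · mulT P) a b
    ≡⟨ cong (ι k * shiftedHermite k a b +_) (trans (mulTⁿ-· k (- ι 2) (mulT P) a b) (cong (- ι 2 *_) (mulTⁿ-mulT k P a b))) ⟩
  ι k * shiftedHermite k a b + - ι 2 * shiftedHermitePred k a b ∎
  where
  S = atXminusT (hermitePoly k)
  P = atXminusT (hermitePolyPred k)

hermitePoly-zero-term : ∀ i c σ → hermitePoly 0 (suc i) * c * σ ≡ 0ℚ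
hermitePoly-zero-term i c σ = trans (cong (λ u → u * c * σ) (hermitePoly-zero i)) (trans (cong (_* σ) (ℚP.*-zeroˡ c)) (ℚP.*-zeroˡ σ))

shiftedHermite-zero : shiftedHermite 0 ≈ oneS
shiftedHermite-zero zero zero = refl
shiftedHermite-zero zero (suc s) = hermitePoly-zero-term s (ι (suc s C suc s)) (sgn (suc s))
shiftedHermite-zero (suc a) s = hermitePoly-zero-term (a ℕ.+ s) (ι ((suc a ℕ.+ s) C s)) (sgn s)

-- e^{2xt − t²} · tᵏ Hₖ(x − t)/k! = Σ_N C(N, k) H_N(x) t^N/N!

binomialHermite : ℕ → Ser
binomialHermite k a N = ι (N C k) * hermiteGF a N

binomialHermite-ladder : ∀ k a N → ι (suc k) * binomialHermite (suc k) a N + ι k * binomialHermite k a N ≡ ι N * binomialHermite k a N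
binomialHermite-ladder k a N = begin
  ι (suc k) * (ι (N C suc k) * h) + ι k * (ι (N C k) * h)
    ≡⟨ solve 5 (λ i c j d x → i :* (c :* x) :+ j :* (d :* x) := (i :* c :+ j :* d) :* x) refl (ι (suc k)) (ι (N C suc k)) (ι k) (ι (N C k)) h ⟩
  (ι (suc k) * ι (N C suc k) + ι k * ι (N C k)) * h
    ≡⟨ cong (_* h) (sym (trans (ι-+ (suc k ℕ.* (N C suc k)) (k ℕ.* (N C k))) (cong₂ _+_ (ι-* (suc k) (N C suc k)) (ι-* k (N C k))))) ⟩
  ι (suc k ℕ.* (N C suc k) ℕ.+ k ℕ.* (N C k)) * h
    ≡⟨ cong (λ u → ι u * h) ([k+1]*nC[k+1]+k*nCk≡n*nCk N k) ⟩
  ι (N ℕ.* (N C k)) * h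
    ≡⟨ trans (cong (_* h) (ι-* N (N C k))) (ℚP.*-assoc (ι N) (ι (N C k)) h) ⟩
  ι N * (ι (N C k) * h) ∎
  where h = hermiteGF a N

hermiteGF-⊛-recurrence : ∀ k →
  ι (suc k) · (hermiteGF ⊛ shiftedHermite (suc k)) ≈
  mulForm (ι 2) (- ι 2) (hermiteGF ⊛ shiftedHermite k) ⊕ (- ι 2) · (hermiteGF ⊛ shiftedHermitePred k)
hermiteGF-⊛-recurrence k =
  ≈-trans (≈-sym (⊛-·ʳ (ι (suc k)) hermiteGF (shiftedHermite (suc k))))
  (≈-trans (⊛-cong (≈-refl {hermiteGF}) (shiftedHermite-recurrence k))
  (≈-trans (⊛-distribˡ-⊕ hermiteGF (mulForm (ι 2) (- ι 2) (shiftedHermite k)) ((- ι 2) · shiftedHermitePred k))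
           (⊕-cong (⊛-mulFormʳ (ι 2) (- ι 2) hermiteGF (shiftedHermite k)) (⊛-·ʳ (- ι 2) hermiteGF (shiftedHermitePred k)))))

θₜ-hermiteGF-⊛ : ∀ k →
  θₜ (hermiteGF ⊛ shiftedHermite k) ≈
  mulForm (ι 2) (- ι 2) (hermiteGF ⊛ shiftedHermite k) ⊕ (ι k · (hermiteGF ⊛ shiftedHermite k) ⊕ (- ι 2) · (hermiteGF ⊛ shiftedHermitePred k))
θₜ-hermiteGF-⊛ k =
  ≈-trans (θₜ-⊛ hermiteGF (shiftedHermite k))
  (⊕-cong (≈-trans (⊛-cong θₜ-hermiteGF (≈-refl {shiftedHermite k})) (⊛-mulFormˡ (ι 2) (- ι 2) hermiteGF (shiftedHermite k)))
          (≈-trans (⊛-cong (≈-refl {hermiteGF}) (θₜ-shiftedHermite k))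
          (≈-trans (⊛-distribˡ-⊕ hermiteGF (ι k · shiftedHermite k) ((- ι 2) · shiftedHermitePred k))
                   (⊕-cong (⊛-·ʳ (ι k) hermiteGF (shiftedHermite k)) (⊛-·ʳ (- ι 2) hermiteGF (shiftedHermitePred k))))))

hermiteGF-⊛-ladder : ∀ k a b →
  ι (suc k) * (hermiteGF ⊛ shiftedHermite (suc k)) a b + ι k * (hermiteGF ⊛ shiftedHermite k) a b ≡ ι b * (hermiteGF ⊛ shiftedHermite k) a b
hermiteGF-⊛-ladder k a b = begin
  ι (suc k) * (hermiteGF ⊛ shiftedHermite (suc k)) a b + ι k * Q a b
    ≡⟨ cong (_+ ι k * Q a b) (hermiteGF-⊛-recurrence k a b) ⟩
  mulForm (ι 2) (- ι 2) Q a b + - ι 2 * E a b + ι k * Q a b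
    ≡⟨ solve 3 (λ m e q → m :+ e :+ q := m :+ (q :+ e)) refl (mulForm (ι 2) (- ι 2) Q a b) (- ι 2 * E a b) (ι k * Q a b) ⟩
  mulForm (ι 2) (- ι 2) Q a b + (ι k * Q a b + - ι 2 * E a b)
    ≡⟨ θₜ-hermiteGF-⊛ k a b ⟨
  ι b * Q a b ∎
  where
  Q = hermiteGF ⊛ shiftedHermite k
  E = hermiteGF ⊛ shiftedHermitePred k

hermiteGF-⊛-shiftedHermite : ∀ k → hermiteGF ⊛ shiftedHermite k ≈ binomialHermite k
hermiteGF-⊛-shiftedHermite zero a b =
  trans (⊛-cong (≈-refl {hermiteGF}) shiftedHermite-zero a b) (trans (⊛-identityʳ hermiteGF a b) (sym (ℚP.*-identityˡ _)))
hermiteGF-⊛-shiftedHermite (suc k) a b = ι-cancelˡ k (∙-cancelʳ (ι k * binomialHermite k a b) _ _ (begin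
  ι (suc k) * (hermiteGF ⊛ shiftedHermite (suc k)) a b + ι k * binomialHermite k a b
    ≡⟨ cong (λ u → ι (suc k) * (hermiteGF ⊛ shiftedHermite (suc k)) a b + ι k * u) (hermiteGF-⊛-shiftedHermite k a b) ⟨
  ι (suc k) * (hermiteGF ⊛ shiftedHermite (suc k)) a b + ι k * (hermiteGF ⊛ shiftedHermite k) a b
    ≡⟨ hermiteGF-⊛-ladder k a b ⟩
  ι b * (hermiteGF ⊛ shiftedHermite k) a b
    ≡⟨ cong (ι b *_) (hermiteGF-⊛-shiftedHermite k a b) ⟩
  ι b * binomialHermite k a b
    ≡⟨ binomialHermite-ladder k a b ⟨
  ι (suc k) * binomialHermite (suc k) a b + ι k * binomialHermite k a b ∎))

-- The alternating binomial transform of the Lucas numbers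

fibonacciLike : ℚ → ℚ → ℕ → ℚ
fibonacciLike p q zero = p
fibonacciLike p q (suc zero) = q
fibonacciLike p q (suc (suc n)) = fibonacciLike p q (suc n) + fibonacciLike p q n

fibonacciLike-suc : ∀ p q n → fibonacciLike p q (suc n) ≡ fibonacciLike q (p + q) n
fibonacciLike-suc p q zero = refl
fibonacciLike-suc p q (suc zero) = ℚP.+-comm q p
fibonacciLike-suc p q (suc (suc n)) = cong₂ _+_ (fibonacciLike-suc p q (suc n)) (fibonacciLike-suc p q n)

fibonacciLike-linear : ∀ c d p q p′ q′ n →
  c * fibonacciLike p q n + d * fibonacciLike p′ q′ n ≡ fibonacciLike (c * p + d * p′) (c * q + d * q′) n
fibonacciLike-linear c d p q p′ q′ zero = refl
fibonacciLike-linear c d p q p′ q′ (suc zero) = refl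
fibonacciLike-linear c d p q p′ q′ (suc (suc n)) = begin
  c * (u (suc n) + u n) + d * (v (suc n) + v n)
    ≡⟨ solve 6 (λ c d a b x y → c :* (a :+ b) :+ d :* (x :+ y) := (c :* a :+ d :* x) :+ (c :* b :+ d :* y)) refl c d (u (suc n)) (u n) (v (suc n)) (v n) ⟩
  (c * u (suc n) + d * v (suc n)) + (c * u n + d * v n)
    ≡⟨ cong₂ _+_ (fibonacciLike-linear c d p q p′ q′ (suc n)) (fibonacciLike-linear c d p q p′ q′ n) ⟩
  fibonacciLike (c * p + d * p′) (c * q + d * q′) (suc (suc n)) ∎
  where
  u = fibonacciLike p q
  v = fibonacciLike p′ q′

lucas≡fibonacciLike : ∀ n → ι (lucas n) ≡ fibonacciLike (ι 2) (ι 1) n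
lucas≡fibonacciLike zero = refl
lucas≡fibonacciLike (suc zero) = refl
lucas≡fibonacciLike (suc (suc n)) = trans (ι-+ (lucas (suc n)) (lucas n)) (cong₂ _+_ (lucas≡fibonacciLike (suc n)) (lucas≡fibonacciLike n))

alternatingBinomial : (ℕ → ℚ) → ℕ → ℚ
alternatingBinomial u N = sumTo N (λ n → sgn n * u n * ι (N C n))

alternatingBinomial-suc : ∀ u N → alternatingBinomial u (suc N) ≡ alternatingBinomial u N + - alternatingBinomial (λ n → u (suc n)) N
alternatingBinomial-suc u N = begin
  sumTo (suc N) (λ n → sgn n * u n * ι (suc N C n))
    ≡⟨ sumTo-unfoldˡ N _ ⟩
  f 0 + sumTo N (λ n → sgn (suc n) * u (suc n) * ι (suc N C suc n))
    ≡⟨ cong (λ x → f 0 + x) (trans (sumTo-cong N pascal) (sumTo-+ N g f′)) ⟩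
  f 0 + (sumTo N g + sumTo N f′)
    ≡⟨ cong (λ x → f 0 + (x + sumTo N f′)) (sumTo-neg N _) ⟩
  f 0 + (- alternatingBinomial (λ n → u (suc n)) N + sumTo N f′)
    ≡⟨ solve 3 (λ a b c → a :+ (b :+ c) := (a :+ c) :+ b) refl (f 0) (- alternatingBinomial (λ n → u (suc n)) N) (sumTo N f′) ⟩
  (f 0 + sumTo N f′) + - alternatingBinomial (λ n → u (suc n)) N
    ≡⟨ cong (_+ - alternatingBinomial (λ n → u (suc n)) N) (trans (sym (sumTo-unfoldˡ N f)) (sumTo-extend f (ℕP.n≤1+n N) top-term)) ⟩
  alternatingBinomial u N + - alternatingBinomial (λ n → u (suc n)) N ∎
  where
  f : ℕ → ℚ
  f n = sgn n * u n * ι (N C n)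
  f′ : ℕ → ℚ
  f′ n = f (suc n)
  g : ℕ → ℚ
  g n = - (sgn n * u (suc n) * ι (N C n))
  pascal : ∀ n → sgn (suc n) * u (suc n) * ι (suc N C suc n) ≡ g n + f′ n
  pascal n = begin
    - sgn n * u (suc n) * ι (suc N C suc n)                     ≡⟨ cong (λ x → - sgn n * u (suc n) * ι x) (nCk+nC[k+1]≡[n+1]C[k+1] N n) ⟨
    - sgn n * u (suc n) * ι (N C n ℕ.+ N C suc n)               ≡⟨ cong (- sgn n * u (suc n) *_) (ι-+ (N C n) (N C suc n)) ⟩
    - sgn n * u (suc n) * (ι (N C n) + ι (N C suc n))
      ≡⟨ solve 4 (λ σ y b c → (:- σ) :* y :* (b :+ c) := (:- (σ :* y :* b)) :+ (:- σ) :* y :* c) refl (sgn n) (u (suc n)) (ι (N C n)) (ι (N C suc n)) ⟩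
    g n + f′ n                                                  ∎
  top-term : ∀ n → N < n → f n ≡ 0ℚ
  top-term n N<n = trans (cong (λ x → sgn n * u n * ι x) (k>n⇒nCk≡0 N<n)) (ℚP.*-zeroʳ (sgn n * u n))

alternatingBinomial-fibonacciLike : ∀ N p q → alternatingBinomial (fibonacciLike p q) N ≡ fibonacciLike p (p + - q) N
alternatingBinomial-fibonacciLike zero p q = solve 1 (λ p → con 1ℚ :* p :* con 1ℚ := p) refl p
alternatingBinomial-fibonacciLike (suc N) p q = begin
  alternatingBinomial (fibonacciLike p q) (suc N)
    ≡⟨ alternatingBinomial-suc (fibonacciLike p q) N ⟩
  alternatingBinomial (fibonacciLike p q) N + - alternatingBinomial (λ n → fibonacciLike p q (suc n)) N
    ≡⟨ cong₂ (λ x y → x + - y) (alternatingBinomial-fibonacciLike N p q)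
         (trans (sumTo-cong N (λ n → cong (λ x → sgn n * x * ι (N C n)) (fibonacciLike-suc p q n))) (alternatingBinomial-fibonacciLike N q (p + q))) ⟩
  fibonacciLike p (p + - q) N + - fibonacciLike q (q + - (p + q)) N
    ≡⟨ solve 2 (λ x y → x :+ (:- y) := con 1ℚ :* x :+ (:- con 1ℚ) :* y) refl (fibonacciLike p (p + - q) N) (fibonacciLike q (q + - (p + q)) N) ⟩
  1ℚ * fibonacciLike p (p + - q) N + - 1ℚ * fibonacciLike q (q + - (p + q)) N
    ≡⟨ fibonacciLike-linear 1ℚ (- 1ℚ) p (p + - q) q (q + - (p + q)) N ⟩
  fibonacciLike (1ℚ * p + - 1ℚ * q) (1ℚ * (p + - q) + - 1ℚ * (q + - (p + q))) N
    ≡⟨ cong₂ (λ x y → fibonacciLike x y N)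
         (solve 2 (λ p q → con 1ℚ :* p :+ (:- con 1ℚ) :* q := p :+ (:- q)) refl p q)
         (solve 2 (λ p q → con 1ℚ :* (p :+ (:- q)) :+ (:- con 1ℚ) :* (q :+ (:- (p :+ q))) := p :+ (p :+ (:- q))) refl p q) ⟩
  fibonacciLike (p + - q) (p + (p + - q)) N
    ≡⟨ fibonacciLike-suc p (p + - q) N ⟨
  fibonacciLike p (p + - q) (suc N) ∎

lucas-alternatingBinomial : ∀ N → alternatingBinomial (λ n → ι (lucas n)) N ≡ ι (lucas N)
lucas-alternatingBinomial N = begin
  alternatingBinomial (λ n → ι (lucas n)) N
    ≡⟨ sumTo-cong N (λ n → cong (λ x → sgn n * x * ι (N C n)) (lucas≡fibonacciLike n)) ⟩
  alternatingBinomial (fibonacciLike (ι 2) (ι 1)) N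
    ≡⟨ alternatingBinomial-fibonacciLike N (ι 2) (ι 1) ⟩
  fibonacciLike (ι 2) (ι 1) N
    ≡⟨ lucas≡fibonacciLike N ⟨
  ι (lucas N) ∎

lhsSer-coefficient : ∀ a N → lhsSer a N ≡ ι (lucas N) * hermiteGF a N
lhsSer-coefficient a N = begin
  ι (lucas N) * (ι (N !) * hermiteGF a N) * invFact N
    ≡⟨ solve 4 (λ l f h i → l :* (f :* h) :* i := l :* h :* (f :* i)) refl (ι (lucas N)) (ι (N !)) (hermiteGF a N) (invFact N) ⟩
  ι (lucas N) * hermiteGF a N * (ι (N !) * invFact N)
    ≡⟨ cong (ι (lucas N) * hermiteGF a N *_) (ι[k!]*invFact[k]≡1 N) ⟩
  ι (lucas N) * hermiteGF a N * 1ℚ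
    ≡⟨ ℚP.*-identityʳ _ ⟩
  ι (lucas N) * hermiteGF a N ∎

shiftedHermite-coefficient : ∀ n a {b} → n ≤ b → shiftedHermite n a b ≡ invFact n * hermiteShift n a (b ∸ n)
shiftedHermite-coefficient n a {b} n≤b = begin
  shiftedHermite n a b
    ≡⟨ cong (shiftedHermite n a) (ℕP.m+[n∸m]≡n n≤b) ⟨
  mulTⁿ n (atXminusT (hermitePoly n)) a (n ℕ.+ s)
    ≡⟨ mulTⁿ-apply n _ a s ⟩
  hermiteGF (a ℕ.+ s) n * ι ((a ℕ.+ s) C s) * sgn s
    ≡⟨ cong (λ x → x * ι ((a ℕ.+ s) C s) * sgn s) (ℚP.*-identityˡ (hermiteGF (a ℕ.+ s) n)) ⟨
  1ℚ * hermiteGF (a ℕ.+ s) n * ι ((a ℕ.+ s) C s) * sgn s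
    ≡⟨ cong (λ x → x * hermiteGF (a ℕ.+ s) n * ι ((a ℕ.+ s) C s) * sgn s) (trans (ℚP.*-comm (invFact n) (ι (n !))) (ι[k!]*invFact[k]≡1 n)) ⟨
  invFact n * ι (n !) * hermiteGF (a ℕ.+ s) n * ι ((a ℕ.+ s) C s) * sgn s
    ≡⟨ solve 5 (λ i f h c σ → i :* f :* h :* c :* σ := i :* (f :* h :* c :* σ)) refl (invFact n) (ι (n !)) (hermiteGF (a ℕ.+ s) n) (ι ((a ℕ.+ s) C s)) (sgn s) ⟩
  invFact n * hermiteShift n a s ∎
  where s = b ∸ n

signedLucas : ℕ → ℚ
signedLucas n = sgn n * ι (lucas n)

-- The summands with n > b vanish because tⁿ divides them.
rhsSum-upTo : ∀ N a {b} → b ≤ N → rhsSum a b ≡ ΣS N (λ n → signedLucas n · shiftedHermite n) a b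
rhsSum-upTo N a {b} b≤N = begin
  rhsSum a b
    ≡⟨ sumTo-cong-≤ b (λ n n≤b → trans (ℚP.*-assoc (signedLucas n) _ _) (cong (signedLucas n *_) (sym (shiftedHermite-coefficient n a n≤b)))) ⟩
  sumTo b (λ n → signedLucas n * shiftedHermite n a b)
    ≡⟨ sumTo-extend _ b≤N (λ n b<n → trans (cong (signedLucas n *_) (mulTⁿ-vanishes n _ a b<n)) (ℚP.*-zeroʳ (signedLucas n))) ⟨
  sumTo N (λ n → signedLucas n * shiftedHermite n a b) ∎

corollary16 : (a n : ℕ) → lhsSer a n ≡ rhsSer a n
corollary16 a N = begin
  lhsSer a N
    ≡⟨ lhsSer-coefficient a N ⟩
  ι (lucas N) * hermiteGF a N
    ≡⟨ cong (_* hermiteGF a N) (lucas-alternatingBinomial N) ⟨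
  alternatingBinomial (λ n → ι (lucas n)) N * hermiteGF a N
    ≡⟨ trans (*-distribʳ-sumTo N _ _) (sumTo-cong N (λ n → ℚP.*-assoc (signedLucas n) _ _)) ⟩
  sumTo N (λ n → signedLucas n * binomialHermite n a N)
    ≡⟨ sumTo-cong N (λ n → cong (signedLucas n *_) (hermiteGF-⊛-shiftedHermite n a N)) ⟨
  ΣS N (λ n → signedLucas n · (hermiteGF ⊛ shiftedHermite n)) a N
    ≡⟨ trans (⊛-ΣS hermiteGF N (λ n → signedLucas n · shiftedHermite n) a N) (sumTo-cong N (λ n → ⊛-·ʳ (signedLucas n) hermiteGF (shiftedHermite n) a N)) ⟨
  (hermiteGF ⊛ ΣS N (λ n → signedLucas n · shiftedHermite n)) a N
    ≡⟨ ⊛-congʳ-upTo hermiteGF N (λ a′ b′ b′≤N → sym (rhsSum-upTo N a′ b′≤N)) a ⟩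
  rhsSer a N ∎
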